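{- (In BISH.) Let $S=\{s_1,s_2,\ldots\}$ be an inhabited, countable, pseudobounded subset of $\mathbf{N}$. Then there exists a sequence $(a_n)_{n\geq1}$ of nonnegative rational numbers such that: (i) the series $\sum (-1)^n a_n$ is convergent and weak-permutably convergent; and (ii) if $\sum a_n$ converges, then $S$ is bounded.
   Context: Work in Bishop-style constructive mathematics (intuitionistic logic). $\mathbf{N}^+$ is the set of positive integers. A subset $S$ of $\mathbf{N}$ is pseudobounded if for every sequence $(t_n)_{n\geq1}$ in $S$ there exists $N$ such that $t_n/n<1$ for all $n\geq N$. A bracketing of a real series $\sum c_n$ is a strictly increasing map $f:\mathbf{N}^+\to\mathbf{N}^+$ with $f(1)=1$ together with the sequence $b_k=\sum_{i=f(k)}^{f(k+1)-1} c_i$ ($k\geq1$); it is convergent if $\sum_k b_k$ converges. A series $\sum c_n$ is weak-permutably convergent if it converges and for every permutation $\sigma$ of $\mathbf{N}^+$ there exists a convergent bracketing of $\sum c_{\sigma(n)}$. -}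

module Defs where

open import Data.Nat using (ℕ; zero; suc; _≤_; _<_; _∸_)
open import Data.Rational using (ℚ; 0ℚ; 1ℚ; _+_; _-_; -_; ∣_∣) renaming (_≤_ to _≤ℚ_; _<_ to _<ℚ_)
open import Data.Product using (Σ; ∃; ∃-syntax; _×_)
open import Function.Bundles using (_↔_; Inverse)
open import Relation.Binary.PropositionalEquality using (_≡_)

-- Convention: a sequence (x_n)_{n ≥ 1} is represented by x : ℕ → A with
-- x i standing for x_{i+1}.  Likewise maps ℕ⁺ → ℕ⁺ are shifted by one.

psum : (ℕ → ℚ) → ℕ → ℚ
psum c zero    = 0ℚ
psum c (suc n) = psum c n + c n

-- A series of rationals converges (in BISH: iff its partial sums form a
-- Cauchy sequence, real numbers being complete).
SeriesConverges : (ℕ → ℚ) → Set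
SeriesConverges c =
  (ε : ℚ) → 0ℚ <ℚ ε → ∃[ N ] ((m n : ℕ) → N ≤ m → N ≤ n → ∣ psum c m - psum c n ∣ ≤ℚ ε)

blockSum : (ℕ → ℚ) → ℕ → ℕ → ℚ
blockSum c a zero      = 0ℚ
blockSum c a (suc len) = c a + blockSum c (suc a) len

-- A bracketing: f strictly increasing with f(1) = 1 (shifted: f 0 ≡ 0);
-- b_k = Σ_{i = f(k)}^{f(k+1)-1} c_i.
StrictlyIncreasing : (ℕ → ℕ) → Set
StrictlyIncreasing f = (k : ℕ) → f k < f (suc k)

bracket : (ℕ → ℚ) → (ℕ → ℕ) → ℕ → ℚ
bracket c f k = blockSum c (f k) (f (suc k) ∸ f k)

HasConvergentBracketing : (ℕ → ℚ) → Set
HasConvergentBracketing c =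
  Σ (ℕ → ℕ) λ f → (f 0 ≡ 0) × StrictlyIncreasing f × SeriesConverges (bracket c f)

WeakPermutablyConvergent : (ℕ → ℚ) → Set
WeakPermutablyConvergent c =
  SeriesConverges c ×
  ((σ : ℕ ↔ ℕ) → HasConvergentBracketing (λ n → c (Inverse.to σ n)))

-- S = { s_1, s_2, ... } ⊆ ℕ given as the range of s : ℕ → ℕ (inhabited).
InRange : (ℕ → ℕ) → ℕ → Set
InRange s x = ∃[ m ] (s m ≡ x)

-- pseudobounded: for every sequence (t_n)_{n≥1} in S there is N with
-- t_n < n for all n ≥ N  (t_n/n < 1).  Shifted: t i is t_{i+1}.
Pseudobounded : (ℕ → ℕ) → Set
Pseudobounded s =
  (t : ℕ → ℕ) → ((i : ℕ) → InRange s (t i)) →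
  ∃[ N ] ((i : ℕ) → N ≤ i → t i < suc i)

Bounded : (ℕ → ℕ) → Set
Bounded s = ∃[ B ] ((m : ℕ) → s m ≤ B)

-- (-1)^n a_n with n = i + 1
altSign : (ℕ → ℚ) → ℕ → ℚ
altSign a zero          = - (a zero)
altSign a (suc zero)    = a (suc zero)
altSign a (suc (suc i)) = altSign (λ j → a (suc (suc j))) i

module Submission where

-- Let t n = max (s 0, …, s n) be the running maximum of the
-- enumeration s of S, put cₙ = 1/(n+1) if t ⌊n/2⌋ < t n and cₙ = 0 otherwise, and take
-- a = c₀, c₀, c₁, c₁, … .  Write x = ((-1)ⁿ aₙ) = -c₀, c₀, -c₁, c₁, … .
--  * The partial sums of x are 0 and -cₙ, so Σ x converges since cₙ ≤ 1/(n+1).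
--  * If Σ a converges, any step t r < t (r+1) past the Cauchy index for ε = ½ yields
--    a block of 2r+2 terms of a, each ≥ 1/(2r+2): a contradiction, so t (and S) is bounded.
--  * In x the partners 2n, 2n+1 carry opposite terms, so a prefix of a rearrangement
--    x ∘ g containing x₀, …, x_{4D-1} and no other nonzero term sums to 0.  This holds
--    whenever t is constant on a suitable window [D, next D].  Among k+1 successive
--    windows either t has such a plateau or t reaches k+1; pseudoboundedness of S rules
--    out the latter for large k, so cutting at plateau windows gives a bracketing
--    whose partial sums are eventually 0.
-- The file develops rational and series facts, even/odd and partner bookkeeping, the
-- cancellation of partner pairs in finite sums and facts on monotone sequences, then
-- the construction (module Construction), and derives lemma4p2 at the end.

open import Defs
open import Data.Nat using (ℕ)
open import Data.Rational using (ℚ; 0ℚ) renaming (_≤_ to _≤ℚ_)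
open import Data.Product using (Σ; _×_)

open import Data.Nat as ℕ using (zero; suc; z≤n; s≤s; _≤_; _<_; _⊔_; ⌊_/2⌋; _≤′_; ≤′-refl; ≤′-step; _<?_; _≤?_)
import Data.Nat.Properties as ℕP
open import Data.Nat.Coprimality using (1-coprimeTo)
open import Data.Integer as ℤ using (+_; +[1+_]; -[1+_]; +≤+; +<+)
import Data.Integer.Properties as ℤP
open import Data.Integer.Tactic.RingSolver using (solve-∀)
open import Data.Rational as ℚ using (mkℚ; 1ℚ; ½; _+_; _-_; -_; ∣_∣; *≤*; *<*) renaming (_<_ to _<ℚ_)
import Data.Rational.Properties as ℚP
import Data.Rational.Unnormalised as ℚᵘ
import Data.Rational.Unnormalised.Properties as ℚᵘP
open import Data.Rational.Solver using (module +-*-Solver)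
open +-*-Solver using (solve; _:+_; _:=_; :-_; con)
open import Algebra.Properties.Group ℚP.+-0-group using (⁻¹-involutive)
open import Data.Product using (_,_; ∃-syntax; Σ-syntax)
open import Data.Sum using (_⊎_; inj₁; inj₂)
open import Data.Empty using (⊥-elim)
open import Relation.Nullary using (¬_; yes; no)
open import Relation.Binary.PropositionalEquality using (_≡_; _≢_; refl; sym; trans; cong; cong₂; subst; module ≡-Reasoning; setoid)
open import Function.Bundles using (_↔_; Inverse)
open import Data.List using (List; []; _∷_; length; applyDownFrom)
open import Data.List.Properties using (length-applyDownFrom)
open import Data.List.Membership.Propositional using (_∈_)
open import Data.List.Membership.Propositional.Properties using (∈-∃++)
open import Data.List.Relation.Unary.Any using (here; there)
import Data.List.Relation.Unary.Any.Properties as Any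
open import Data.List.Relation.Unary.All as All using (_∷_)
open import Data.List.Relation.Unary.AllPairs using (_∷_)
open import Data.List.Relation.Unary.Unique.Propositional using (Unique)
import Data.List.Relation.Unary.Unique.Propositional.Properties as Unique
open import Data.List.Relation.Binary.Permutation.Propositional as ↭ using (_↭_; ↭-sym; ↭⇒↭ₛ)
open import Data.List.Relation.Binary.Permutation.Propositional.Properties using (∈-resp-↭; ↭-length; shift)
open import Data.List.Relation.Binary.Permutation.Setoid.Properties (setoid ℕ) using (Unique-resp-↭)

-- u n = 1/(n+1): the weights from which the sequence of the theorem is built.
u : ℕ → ℚ
u n = mkℚ (+ 1) n (1-coprimeTo (suc n))

u-nonneg : ∀ n → 0ℚ ≤ℚ u n
u-nonneg n = *≤* (+≤+ z≤n)

u-antitone : ∀ {m n} → m ≤ n → u n ≤ℚ u m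
u-antitone m≤n = *≤* (+≤+ (ℕP.+-monoˡ-≤ 0 (s≤s m≤n)))

u-archimedean : ∀ ε → 0ℚ <ℚ ε → ∃[ K ] u K ≤ℚ ε
u-archimedean (mkℚ (+ zero) _ _) (*<* (+<+ ()))
u-archimedean (mkℚ +[1+ n ] d _) _ = d , *≤* (+≤+ (s≤s (ℕP.+-monoʳ-≤ d (z≤n {n ℕ.* suc d}))))
u-archimedean (mkℚ -[1+ _ ] _ _) (*<* ())

copies : ℕ → ℚ → ℚ
copies zero    δ = 0ℚ
copies (suc l) δ = δ + copies l δ

copies-u : ∀ n l → ℚ.toℚᵘ (copies l (u n)) ℚᵘ.≃ ℚᵘ.mkℚᵘ (+ l) n
copies-u n zero    = ℚᵘ.*≡* refl
copies-u n (suc l) = ℚᵘP.≃-trans (ℚP.toℚᵘ-homo-+ (u n) (copies l (u n)))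
  (ℚᵘP.≃-trans (ℚᵘP.+-congʳ (ℚ.toℚᵘ (u n)) (copies-u n l))
    (ℚᵘ.*≡* (trans (distrib (+ l) (+ suc n)) (cong (+ suc l ℤ.*_) (sym (ℤP.pos-* (suc n) (suc n)))))))
  where
  distrib : ∀ A B → (+ 1 ℤ.* B ℤ.+ A ℤ.* B) ℤ.* B ≡ (+ 1 ℤ.+ A) ℤ.* (B ℤ.* B)
  distrib = solve-∀

copies-u-one : ∀ n → copies (suc n) (u n) ≡ 1ℚ
copies-u-one n = ℚP.toℚᵘ-injective
  (ℚᵘP.≃-trans (copies-u n (suc n)) (ℚᵘ.*≡* (ℤP.*-comm (+ suc n) (+ 1))))

neg-involutive : ∀ p → - (- p) ≡ p
neg-involutive = ⁻¹-involutive

∣∣≤ : ∀ {w δ} → - δ ≤ℚ w → w ≤ℚ δ → ∣ w ∣ ≤ℚ δ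
∣∣≤ {w} {δ} -δ≤w w≤δ with ℚP.∣p∣≡p∨∣p∣≡-p w
... | inj₁ ∣w∣≡w  rewrite ∣w∣≡w  = w≤δ
... | inj₂ ∣w∣≡-w rewrite ∣w∣≡-w = subst (- w ≤ℚ_) (neg-involutive δ) (ℚP.neg-antimono-≤ -δ≤w)

p≤∣p∣ : ∀ p → p ≤ℚ ∣ p ∣
p≤∣p∣ p with ℚP.∣p∣≡p∨∣p∣≡-p p
... | inj₁ ∣p∣≡p  = ℚP.≤-reflexive (sym ∣p∣≡p)
... | inj₂ ∣p∣≡-p = ℚP.≤-trans p≤0 (ℚP.0≤∣p∣ p)
  where
  p≤0 : p ≤ℚ 0ℚ
  p≤0 = subst (_≤ℚ 0ℚ) (neg-involutive p)
          (ℚP.neg-antimono-≤ (subst (0ℚ ≤ℚ_) ∣p∣≡-p (ℚP.0≤∣p∣ p)))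

dist-in-interval : ∀ {p q δ} → - δ ≤ℚ p → p ≤ℚ 0ℚ → - δ ≤ℚ q → q ≤ℚ 0ℚ → ∣ p - q ∣ ≤ℚ δ
dist-in-interval {p} {q} {δ} -δ≤p p≤0 -δ≤q q≤0 = ∣∣≤ lower upper
  where
  lower : - δ ≤ℚ p - q
  lower = subst (_≤ℚ p - q) (ℚP.+-identityʳ (- δ)) (ℚP.+-mono-≤ -δ≤p (ℚP.neg-antimono-≤ q≤0))
  upper : p - q ≤ℚ δ
  upper = subst (p - q ≤ℚ_) (ℚP.+-identityˡ δ)
            (ℚP.+-mono-≤ p≤0 (subst (- q ≤ℚ_) (neg-involutive δ) (ℚP.neg-antimono-≤ -δ≤q)))

psum-split : ∀ c p l → psum c (p ℕ.+ l) ≡ psum c p + blockSum c p l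
psum-split c p zero    = trans (cong (psum c) (ℕP.+-identityʳ p)) (sym (ℚP.+-identityʳ (psum c p)))
psum-split c p (suc l) = begin
    psum c (p ℕ.+ suc l)                      ≡⟨ cong (psum c) (ℕP.+-suc p l) ⟩
    psum c (suc p ℕ.+ l)                      ≡⟨ psum-split c (suc p) l ⟩
    (psum c p + c p) + blockSum c (suc p) l   ≡⟨ ℚP.+-assoc (psum c p) (c p) _ ⟩
    psum c p + (c p + blockSum c (suc p) l)   ∎
  where open ≡-Reasoning

psum-difference : ∀ c p l → psum c (p ℕ.+ l) - psum c p ≡ blockSum c p l
psum-difference c p l = trans (cong (_- psum c p) (psum-split c p l)) (cancel (psum c p) (blockSum c p l))
  where
  cancel : ∀ P B → P + B - P ≡ B
  cancel = solve 2 (λ P B → P :+ B :+ (:- P) := B) refl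

psum-bracket : ∀ c f → f 0 ≡ 0 → StrictlyIncreasing f → ∀ k → psum (bracket c f) k ≡ psum c (f k)
psum-bracket c f f0≡0 f-inc zero    = cong (psum c) (sym f0≡0)
psum-bracket c f f0≡0 f-inc (suc k) = begin
    psum (bracket c f) k + bracket c f k                  ≡⟨ cong (_+ bracket c f k) (psum-bracket c f f0≡0 f-inc k) ⟩
    psum c (f k) + blockSum c (f k) (f (suc k) ℕ.∸ f k)   ≡⟨ sym (psum-split c (f k) _) ⟩
    psum c (f k ℕ.+ (f (suc k) ℕ.∸ f k))                  ≡⟨ cong (psum c) (ℕP.m+[n∸m]≡n (ℕP.<⇒≤ (f-inc k))) ⟩
    psum c (f (suc k))                                    ∎
  where open ≡-Reasoning

eventually-zero⇒converges : ∀ c N → (∀ m → N ≤ m → psum c m ≡ 0ℚ) → SeriesConverges c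
eventually-zero⇒converges c N zero-from ε 0<ε = N , λ m n N≤m N≤n →
  subst (λ d → ∣ d ∣ ≤ℚ ε) (sym (cong₂ _-_ (zero-from m N≤m) (zero-from n N≤n))) (ℚP.<⇒≤ 0<ε)

squeezed⇒converges : ∀ c →
  (∀ K → ∃[ N ] ∀ m → N ≤ m → (- u K ≤ℚ psum c m) × (psum c m ≤ℚ 0ℚ)) → SeriesConverges c
squeezed⇒converges c squeeze ε 0<ε with u-archimedean ε 0<ε
... | K , uK≤ε with squeeze K
...   | N , within = N , λ m n N≤m N≤n →
  let (lo-m , hi-m) = within m N≤m
      (lo-n , hi-n) = within n N≤n
  in ℚP.≤-trans (dist-in-interval lo-m hi-m lo-n hi-n) uK≤ε

blockSum-lower : ∀ c δ p l → (∀ i → p ≤ i → i < p ℕ.+ l → δ ≤ℚ c i) → copies l δ ≤ℚ blockSum c p l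
blockSum-lower c δ p zero    _     = ℚP.≤-refl
blockSum-lower c δ p (suc l) large =
  ℚP.+-mono-≤ (large p ℕP.≤-refl (ℕP.m<m+n p (s≤s z≤n)))
              (blockSum-lower c δ (suc p) l λ i p<i i<p+1+l →
                 large i (ℕP.<⇒≤ p<i) (subst (i <_) (sym (ℕP.+-suc p l)) i<p+1+l))

-- dbl n = 2n, by the same two-step recursion that altSign uses.
dbl : ℕ → ℕ
dbl zero    = zero
dbl (suc n) = suc (suc (dbl n))

data Parity : ℕ → Set where
  even : ∀ n → Parity (dbl n)
  odd  : ∀ n → Parity (suc (dbl n))

parity : ∀ m → Parity m
parity zero       = even zero
parity (suc zero) = odd zero
parity (suc (suc m)) with parity m
... | even n = even (suc n)
... | odd n  = odd (suc n)

half-dbl : ∀ n → ⌊ dbl n /2⌋ ≡ n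
half-dbl zero    = refl
half-dbl (suc n) = cong suc (half-dbl n)

half-suc-dbl : ∀ n → ⌊ suc (dbl n) /2⌋ ≡ n
half-suc-dbl zero    = refl
half-suc-dbl (suc n) = cong suc (half-suc-dbl n)

dbl≡+ : ∀ n → dbl n ≡ n ℕ.+ n
dbl≡+ zero    = refl
dbl≡+ (suc n) = cong suc (trans (cong suc (dbl≡+ n)) (sym (ℕP.+-suc n n)))

n≤dbl : ∀ n → n ≤ dbl n
n≤dbl n = subst (n ≤_) (sym (dbl≡+ n)) (ℕP.m≤m+n n n)

dbl≤⇒≤half : ∀ K m → dbl K ≤ m → K ≤ ⌊ m /2⌋
dbl≤⇒≤half K m 2K≤m = subst (_≤ ⌊ m /2⌋) (half-dbl K) (ℕP.⌊n/2⌋-mono 2K≤m)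

<dbl⇒half< : ∀ i M → i < dbl M → ⌊ i /2⌋ < M
<dbl⇒half< zero          (suc M) _                   = s≤s z≤n
<dbl⇒half< (suc zero)    (suc M) _                   = s≤s z≤n
<dbl⇒half< (suc (suc i)) (suc M) (s≤s (s≤s i<2M))    = s≤s (<dbl⇒half< i M i<2M)

partner : ℕ → ℕ
partner zero          = suc zero
partner (suc zero)    = zero
partner (suc (suc j)) = suc (suc (partner j))

partner-dbl : ∀ n → partner (dbl n) ≡ suc (dbl n)
partner-dbl zero    = refl
partner-dbl (suc n) = cong (λ m → suc (suc m)) (partner-dbl n)

partner-suc-dbl : ∀ n → partner (suc (dbl n)) ≡ dbl n
partner-suc-dbl zero    = refl
partner-suc-dbl (suc n) = cong (λ m → suc (suc m)) (partner-suc-dbl n)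

partner-involutive : ∀ j → partner (partner j) ≡ j
partner-involutive zero          = refl
partner-involutive (suc zero)    = refl
partner-involutive (suc (suc j)) = cong (λ m → suc (suc m)) (partner-involutive j)

partner-injective : ∀ {i j} → partner i ≡ partner j → i ≡ j
partner-injective {i} {j} eq =
  trans (sym (partner-involutive i)) (trans (cong partner eq) (partner-involutive j))

partner-irreflexive : ∀ j → partner j ≢ j
partner-irreflexive zero          ()
partner-irreflexive (suc zero)    ()
partner-irreflexive (suc (suc j)) eq = partner-irreflexive j (cong (λ m → ℕ.pred (ℕ.pred m)) eq)

partner-< : ∀ j K → j < dbl K → partner j < dbl K
partner-< zero          (suc K) _                 = s≤s (s≤s z≤n)
partner-< (suc zero)    (suc K) _                 = s≤s z≤n
partner-< (suc (suc j)) (suc K) (s≤s (s≤s j<2K))  = s≤s (s≤s (partner-< j K j<2K))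

monotone : ∀ (f : ℕ → ℕ) → (∀ n → f n ≤ f (suc n)) → ∀ {m n} → m ≤ n → f m ≤ f n
monotone f step m≤n = go (ℕP.≤⇒≤′ m≤n)
  where
  go : ∀ {m n} → m ≤′ n → f m ≤ f n
  go ≤′-refl        = ℕP.≤-refl
  go (≤′-step m≤′n) = ℕP.≤-trans (go m≤′n) (step _)

step-up : ∀ (f : ℕ → ℕ) {N m} → N ≤ m → f N < f m → ∃[ r ] N ≤ r × r < m × f r < f (suc r)
step-up f {N} N≤m = go (ℕP.≤⇒≤′ N≤m)
  where
  go : ∀ {m} → N ≤′ m → f N < f m → ∃[ r ] N ≤ r × r < m × f r < f (suc r)
  go ≤′-refl fN<fN = ⊥-elim (ℕP.<-irrefl refl fN<fN)
  go (≤′-step {m} N≤′m) fN<fm+1 with f N <? f m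
  ... | yes fN<fm = let (r , N≤r , r<m , jump) = go N≤′m fN<fm in r , N≤r , ℕP.m<n⇒m<1+n r<m , jump
  ... | no  fN≮fm = m , ℕP.≤′⇒≤ N≤′m , ℕP.n<1+n m , ℕP.≤-<-trans (ℕP.≮⇒≥ fN≮fm) fN<fm+1

plateau-or-growth : ∀ (T : ℕ → ℕ) → (∀ i → T i ≤ T (suc i)) → ∀ k →
  (∃[ i ] i ≤ k × T i ≡ T (suc i)) ⊎ suc k ≤ T (suc k)
plateau-or-growth T step zero with T 0 ℕ.≟ T 1
... | yes same = inj₁ (0 , z≤n , same)
... | no  diff = inj₂ (ℕP.≤-<-trans z≤n (ℕP.≤∧≢⇒< (step 0) diff))
plateau-or-growth T step (suc k) with plateau-or-growth T step k
... | inj₁ (i , i≤k , same) = inj₁ (i , ℕP.m≤n⇒m≤1+n i≤k , same)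
... | inj₂ grown with T (suc k) ℕ.≟ T (suc (suc k))
...   | yes same = inj₁ (suc k , ℕP.≤-refl , same)
...   | no  diff = inj₂ (ℕP.<-≤-trans (s≤s grown) (ℕP.≤∧≢⇒< (step (suc k)) diff))

maxBelow : (ℕ → ℕ) → ℕ → ℕ
maxBelow F zero    = zero
maxBelow F (suc L) = maxBelow F L ⊔ F L

maxBelow-bound : ∀ F {j} L → j < L → F j ≤ maxBelow F L
maxBelow-bound F {j} (suc L) j<1+L with j ℕ.≟ L
... | yes refl = ℕP.m≤n⊔m (maxBelow F L) (F L)
... | no  j≢L  = ℕP.≤-trans (maxBelow-bound F L (ℕP.≤∧≢⇒< (ℕP.≤-pred j<1+L) j≢L))
                            (ℕP.m≤m⊔n (maxBelow F L) (F L))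

dup : (ℕ → ℚ) → ℕ → ℚ
dup c i = c ⌊ i /2⌋

altSign-even : ∀ a n → altSign a (dbl n) ≡ - a (dbl n)
altSign-even a zero    = refl
altSign-even a (suc n) = altSign-even (λ j → a (suc (suc j))) n

altSign-odd : ∀ a n → altSign a (suc (dbl n)) ≡ a (suc (dbl n))
altSign-odd a zero    = refl
altSign-odd a (suc n) = altSign-odd (λ j → a (suc (suc j))) n

module AlternatingDuplicate (c : ℕ → ℚ) where

  x : ℕ → ℚ
  x = altSign (dup c)

  x-even : ∀ n → x (dbl n) ≡ - c n
  x-even n = trans (altSign-even (dup c) n) (cong (λ m → - c m) (half-dbl n))

  x-odd : ∀ n → x (suc (dbl n)) ≡ c n
  x-odd n = trans (altSign-odd (dup c) n) (cong c (half-suc-dbl n))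

  -- Partners carry opposite terms; this is what makes rearranged sums cancel.
  x-partner : ∀ j → x (partner j) ≡ - x j
  x-partner j with parity j
  ... | even n = begin
      x (partner (dbl n))  ≡⟨ cong x (partner-dbl n) ⟩
      x (suc (dbl n))      ≡⟨ x-odd n ⟩
      c n                  ≡⟨ sym (neg-involutive (c n)) ⟩
      - (- c n)            ≡⟨ cong -_ (sym (x-even n)) ⟩
      - x (dbl n)          ∎
    where open ≡-Reasoning
  ... | odd n = begin
      x (partner (suc (dbl n)))  ≡⟨ cong x (partner-suc-dbl n) ⟩
      x (dbl n)                  ≡⟨ x-even n ⟩
      - c n                      ≡⟨ cong -_ (sym (x-odd n)) ⟩
      - x (suc (dbl n))          ∎
    where open ≡-Reasoning

  x-support : ∀ j → x j ≢ 0ℚ → c ⌊ j /2⌋ ≢ 0ℚ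
  x-support j xj≢0 cj≡0 with parity j
  ... | even n = xj≢0 (trans (x-even n) (cong -_ (trans (cong c (sym (half-dbl n))) cj≡0)))
  ... | odd n  = xj≢0 (trans (x-odd n) (trans (cong c (sym (half-suc-dbl n))) cj≡0))

  psum-even : ∀ n → psum x (dbl n) ≡ 0ℚ
  psum-odd  : ∀ n → psum x (suc (dbl n)) ≡ - c n
  psum-even zero    = refl
  psum-even (suc n) = trans (cong₂ _+_ (psum-odd n) (x-odd n)) (ℚP.+-inverseˡ (c n))
  psum-odd n = trans (cong₂ _+_ (psum-even n) (x-even n)) (ℚP.+-identityˡ (- c n))

  module _ (c-nonneg : ∀ n → 0ℚ ≤ℚ c n) (c≤u : ∀ n → c n ≤ℚ u n) where

    psum-squeezed : ∀ K m → dbl K ≤ m → (- u K ≤ℚ psum x m) × (psum x m ≤ℚ 0ℚ)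
    psum-squeezed K m 2K≤m with parity m
    ... | even n rewrite psum-even n = ℚP.neg-antimono-≤ (u-nonneg K) , ℚP.≤-refl
    ... | odd n  rewrite psum-odd n  =
      ℚP.neg-antimono-≤ (ℚP.≤-trans (c≤u n) (u-antitone K≤n)) , ℚP.neg-antimono-≤ (c-nonneg n)
      where
      K≤n : K ≤ n
      K≤n = subst (K ≤_) (half-suc-dbl n) (dbl≤⇒≤half K (suc (dbl n)) 2K≤m)

    alternating-converges : SeriesConverges x
    alternating-converges = squeezed⇒converges x λ K → dbl K , psum-squeezed K

module PairCancellation (x : ℕ → ℚ) (x-partner : ∀ j → x (partner j) ≡ - x j) where

  listSum : List ℕ → ℚ
  listSum []      = 0ℚ
  listSum (j ∷ L) = x j + listSum L

  listSum-↭ : ∀ {L L′} → L ↭ L′ → listSum L ≡ listSum L′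
  listSum-↭ ↭.refl            = refl
  listSum-↭ (↭.prep j L↭L′)   = cong (λ r → x j + r) (listSum-↭ L↭L′)
  listSum-↭ (↭.swap i j L↭L′) = trans (cong (λ r → x i + (x j + r)) (listSum-↭ L↭L′)) (exchange (x i) (x j) _)
    where
    exchange : ∀ p q r → p + (q + r) ≡ q + (p + r)
    exchange = solve 3 (λ p q r → p :+ (q :+ r) := q :+ (p :+ r)) refl
  listSum-↭ (↭.trans L↭M M↭L′) = trans (listSum-↭ L↭M) (listSum-↭ M↭L′)

  PartnerClosed : List ℕ → Set
  PartnerClosed L = ∀ {q} → q ∈ L → x q ≢ 0ℚ → partner q ∈ L

  closed-↭ : ∀ {L L′} → L ↭ L′ → PartnerClosed L → PartnerClosed L′
  closed-↭ L↭L′ closed q∈L′ xq≢0 = ∈-resp-↭ L↭L′ (closed (∈-resp-↭ (↭-sym L↭L′) q∈L′) xq≢0)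

  extract : ∀ {v L} → v ∈ L → Σ[ R ∈ List ℕ ] L ↭ v ∷ R
  extract {v} v∈L with ∈-∃++ v∈L
  ... | A , B , refl = _ , shift v A B

  partner-null : ∀ q → x (partner q) ≡ 0ℚ → x q ≡ 0ℚ
  partner-null q x′≡0 = trans (sym (neg-involutive (x q))) (cong -_ (trans (sym (x-partner q)) x′≡0))

  drop-null : ∀ {j L} → x j ≡ 0ℚ → PartnerClosed (j ∷ L) → PartnerClosed L
  drop-null {j} xj≡0 closed {q} q∈L xq≢0 with closed (there q∈L) xq≢0
  ... | here q′≡j  = ⊥-elim (xq≢0 (partner-null q (trans (cong x q′≡j) xj≡0)))
  ... | there q′∈L = q′∈L

  drop-pair : ∀ {j R} → Unique (j ∷ partner j ∷ R) → PartnerClosed (j ∷ partner j ∷ R) → PartnerClosed R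
  drop-pair {j} ((_ ∷ j∉R) ∷ (j′∉R ∷ _)) closed {q} q∈R xq≢0 with closed (there (there q∈R)) xq≢0
  ... | here q′≡j           = ⊥-elim (All.lookup j′∉R q∈R (sym (trans (sym (partner-involutive q)) (cong partner q′≡j))))
  ... | there (here q′≡j′)  = ⊥-elim (All.lookup j∉R q∈R (sym (partner-injective q′≡j′)))
  ... | there (there q′∈R) = q′∈R

  partner-in-tail : ∀ {j L} → PartnerClosed (j ∷ L) → x j ≢ 0ℚ → partner j ∈ L
  partner-in-tail {j} closed xj≢0 with closed (here refl) xj≢0
  ... | here j′≡j  = ⊥-elim (partner-irreflexive j j′≡j)
  ... | there j′∈L = j′∈L

  cancel : ∀ n L → length L ≤ n → Unique L → PartnerClosed L → listSum L ≡ 0ℚ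
  cancel n [] _ _ _ = refl
  cancel (suc n) (j ∷ L) (s≤s len) uniq@(_ ∷ uniq-L) closed with x j ℚ.≟ 0ℚ
  ... | yes xj≡0 = trans (cong₂ _+_ xj≡0 (cancel n L len uniq-L (drop-null xj≡0 closed))) (ℚP.+-identityˡ 0ℚ)
  ... | no  xj≢0 with extract (partner-in-tail closed xj≢0)
  ...   | R , L↭j′∷R = begin
      listSum (j ∷ L)                        ≡⟨ listSum-↭ perm ⟩
      x j + (x (partner j) + listSum R)      ≡⟨ cong₂ (λ p r → x j + (p + r)) (x-partner j) (cancel n R len-R uniq-R closed-R) ⟩
      x j + (- x j + 0ℚ)                     ≡⟨ annihilate (x j) ⟩
      0ℚ                                     ∎
    where
    open ≡-Reasoning
    perm : j ∷ L ↭ j ∷ partner j ∷ R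
    perm = ↭.prep j L↭j′∷R
    uniq′ : Unique (j ∷ partner j ∷ R)
    uniq′ = Unique-resp-↭ (↭⇒↭ₛ perm) uniq
    uniq-R : Unique R
    uniq-R with uniq′
    ... | _ ∷ (_ ∷ u-R) = u-R
    closed-R : PartnerClosed R
    closed-R = drop-pair uniq′ (closed-↭ perm closed)
    len-R : length R ≤ n
    len-R = ℕP.≤-trans (ℕP.n≤1+n _) (subst (_≤ n) (↭-length L↭j′∷R) len)
    annihilate : ∀ p → p + (- p + 0ℚ) ≡ 0ℚ
    annihilate = solve 1 (λ p → p :+ (:- p :+ con 0ℚ) := con 0ℚ) refl

module RearrangedPrefix (x : ℕ → ℚ) (x-partner : ∀ j → x (partner j) ≡ - x j) (σ : ℕ ↔ ℕ) where
  open PairCancellation x x-partner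

  g h : ℕ → ℕ
  g = Inverse.to σ
  h = Inverse.from σ

  y : ℕ → ℚ
  y n = x (g n)

  prefix : ℕ → List ℕ
  prefix = applyDownFrom g

  psum-prefix : ∀ m → psum y m ≡ listSum (prefix m)
  psum-prefix zero    = refl
  psum-prefix (suc m) = trans (ℚP.+-comm (psum y m) (y m)) (cong (λ r → y m + r) (psum-prefix m))

  prefix-unique : ∀ m → Unique (prefix m)
  prefix-unique m = Unique.applyDownFrom⁺₁ g m λ {i} {j} j<i _ gi≡gj →
    ℕP.<-irrefl (g-injective (sym gi≡gj)) j<i
    where
    g-injective : ∀ {i j} → g i ≡ g j → i ≡ j
    g-injective {i} {j} gi≡gj =
      trans (sym (Inverse.strictlyInverseʳ σ i)) (trans (cong h gi≡gj) (Inverse.strictlyInverseʳ σ j))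

  prefix-vanishes : ∀ K m → (∀ j → j < dbl K → h j < m) → (∀ p → p < m → y p ≢ 0ℚ → g p < dbl K) →
    psum y m ≡ 0ℚ
  prefix-vanishes K m covers confined =
    trans (psum-prefix m) (cancel m (prefix m) (ℕP.≤-reflexive (length-applyDownFrom g m)) (prefix-unique m) closed)
    where
    closed : PartnerClosed (prefix m)
    closed {q} q∈prefix xq≢0 with Any.applyDownFrom⁻ g q∈prefix
    ... | p , p<m , refl =
      subst (_∈ prefix m) (Inverse.strictlyInverseˡ σ (partner q))
        (Any.applyDownFrom⁺ g refl (covers (partner q) (partner-< q K (confined p p<m xq≢0))))

module Construction (s : ℕ → ℕ) where

  t : ℕ → ℕ
  t zero    = s zero
  t (suc n) = t n ⊔ s (suc n)

  t-step : ∀ n → t n ≤ t (suc n)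
  t-step n = ℕP.m≤m⊔n (t n) (s (suc n))

  t-mono : ∀ {m n} → m ≤ n → t m ≤ t n
  t-mono = monotone t t-step

  s≤t : ∀ n → s n ≤ t n
  s≤t zero    = ℕP.≤-refl
  s≤t (suc n) = ℕP.m≤n⊔m (t n) (s (suc n))

  t-in-S : ∀ n → InRange s (t n)
  t-in-S zero = zero , refl
  t-in-S (suc n) with ℕP.⊔-sel (t n) (s (suc n))
  ... | inj₁ t′≡t = let (m , sm≡tn) = t-in-S n in m , trans sm≡tn (sym t′≡t)
  ... | inj₂ t′≡s = suc n , sym t′≡s

  Grows : ℕ → Set
  Grows n = t ⌊ n /2⌋ < t n

  c : ℕ → ℚ
  c n with t ⌊ n /2⌋ <? t n
  ... | yes _ = u n
  ... | no  _ = 0ℚ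

  c-nonneg : ∀ n → 0ℚ ≤ℚ c n
  c-nonneg n with t ⌊ n /2⌋ <? t n
  ... | yes _ = u-nonneg n
  ... | no  _ = ℚP.≤-refl

  c≤u : ∀ n → c n ≤ℚ u n
  c≤u n with t ⌊ n /2⌋ <? t n
  ... | yes _ = ℚP.≤-refl
  ... | no  _ = u-nonneg n

  c-support : ∀ n → c n ≢ 0ℚ → Grows n
  c-support n cn≢0 with t ⌊ n /2⌋ <? t n
  ... | yes grows = grows
  ... | no  _     = ⊥-elim (cn≢0 refl)

  c-grows : ∀ n → Grows n → c n ≡ u n
  c-grows n grows with t ⌊ n /2⌋ <? t n
  ... | yes _        = refl
  ... | no  ¬grows   = ⊥-elim (¬grows grows)

  a : ℕ → ℚ
  a = dup c

  open AlternatingDuplicate c public using (x; x-partner; x-support)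

  x-converges : SeriesConverges x
  x-converges = AlternatingDuplicate.alternating-converges c c-nonneg c≤u

  -- A step t r < t (r+1) makes all of a_{2r+2}, …, a_{4r+3} at least 1/(2r+2),
  -- so this block of 2r+2 terms sums to at least 1.
  step-up-block : ∀ r → t r < t (suc r) → 1ℚ ≤ℚ blockSum a (dbl (suc r)) (dbl (suc r))
  step-up-block r jump = subst (_≤ℚ blockSum a p p) (copies-u-one k) (blockSum-lower a (u k) p p large)
    where
    p k : ℕ
    p = dbl (suc r)
    k = suc (dbl r)
    large : ∀ i → p ≤ i → i < p ℕ.+ p → u k ≤ℚ a i
    large i p≤i i<2p = subst (u k ≤ℚ_) (sym (c-grows n grows)) (u-antitone (ℕP.≤-pred n<p))
      where
      n : ℕ
      n = ⌊ i /2⌋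
      n<p : n < p
      n<p = <dbl⇒half< i p (subst (i <_) (sym (dbl≡+ p)) i<2p)
      grows : Grows n
      grows = ℕP.≤-<-trans (t-mono (ℕP.≤-pred (<dbl⇒half< n (suc r) n<p)))
                (ℕP.<-≤-trans jump (t-mono (dbl≤⇒≤half (suc r) i p≤i)))

  -- (ii): if Σ aₙ converges, S is bounded by t N, N chosen for the Cauchy condition with ε = ½:
  -- a step of t after N would give a block beyond N of sum at least 1.
  bounded : SeriesConverges a → Bounded s
  bounded converges with converges ½ (*<* (+<+ (s≤s z≤n)))
  ... | N , cauchy = t N , bound
    where
    1≰½ : ¬ (1ℚ ≤ℚ ½)
    1≰½ (*≤* (+≤+ (s≤s ())))

    no-step-after : ∀ r → N ≤ r → ¬ (t r < t (suc r))
    no-step-after r N≤r jump = 1≰½ (ℚP.≤-trans (step-up-block r jump) (ℚP.≤-trans (p≤∣p∣ _) close))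
      where
      p : ℕ
      p = dbl (suc r)
      N≤p : N ≤ p
      N≤p = ℕP.≤-trans N≤r (ℕP.≤-trans (ℕP.n≤1+n r) (n≤dbl (suc r)))
      close : ∣ blockSum a p p ∣ ≤ℚ ½
      close = subst (λ d → ∣ d ∣ ≤ℚ ½) (psum-difference a p p)
                (cauchy (p ℕ.+ p) p (ℕP.≤-trans N≤p (ℕP.m≤m+n p p)) N≤p)

    bound : ∀ m → s m ≤ t N
    bound m with s m ≤? t N
    ... | yes sm≤tN = sm≤tN
    ... | no  sm≰tN =
      let (r , N≤r , _ , jump) = step-up t N≤m tN<tm in ⊥-elim (no-step-after r N≤r jump)
      where
      tN<tm : t N < t m
      tN<tm = ℕP.<-≤-trans (ℕP.≰⇒> sm≰tN) (s≤t m)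
      N≤m : N ≤ m
      N≤m = ℕP.≮⇒≥ λ m<N → ℕP.<⇒≱ tN<tm (t-mono (ℕP.<⇒≤ m<N))

  module Rearrangement (σ : ℕ ↔ ℕ) where
    open RearrangedPrefix x x-partner σ using (g; h; y; prefix-vanishes)

    -- cover D rearranged terms contain all of x₀, …, x_{4D-1};
    -- every x-index among them is below reach D.
    cover reach next : ℕ → ℕ
    cover D = dbl (dbl D) ⊔ suc (maxBelow h (dbl (dbl D)))
    reach D = suc (maxBelow g (cover D))
    next D  = D ℕ.+ reach D

    ≤-cover : ∀ D → D ≤ cover D
    ≤-cover D = ℕP.≤-trans (n≤dbl D) (ℕP.≤-trans (n≤dbl (dbl D)) (ℕP.m≤m⊔n _ _))

    -- If t is constant on [D, next D], the first cover D rearranged terms cancel: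
    -- a nonzero x_q with 4D ≤ q < reach D would need t to grow between ⌊q/4⌋ ≥ D and ⌊q/2⌋ < next D.
    window-vanishes : ∀ D → t D ≡ t (next D) → psum y (cover D) ≡ 0ℚ
    window-vanishes D flat = prefix-vanishes (dbl D) (cover D) covered confined
      where
      covered : ∀ j → j < dbl (dbl D) → h j < cover D
      covered j j<4D = ℕP.<-≤-trans (s≤s (maxBelow-bound h (dbl (dbl D)) j<4D)) (ℕP.m≤n⊔m _ _)
      confined : ∀ p → p < cover D → y p ≢ 0ℚ → g p < dbl (dbl D)
      confined p p<cover yp≢0 with g p <? dbl (dbl D)
      ... | yes gp<4D = gp<4D
      ... | no  gp≮4D = ⊥-elim (ℕP.<-irrefl flat (ℕP.≤-<-trans (t-mono D≤n/2) (ℕP.<-≤-trans grows (t-mono n≤next))))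
        where
        n : ℕ
        n = ⌊ g p /2⌋
        grows : Grows n
        grows = c-support n (x-support (g p) yp≢0)
        D≤n/2 : D ≤ ⌊ n /2⌋
        D≤n/2 = dbl≤⇒≤half D n (dbl≤⇒≤half (dbl D) (g p) (ℕP.≮⇒≥ gp≮4D))
        n≤next : n ≤ next D
        n≤next = ℕP.≤-trans (ℕP.⌊n/2⌋≤n (g p))
                   (ℕP.≤-trans (ℕP.<⇒≤ (s≤s (maxBelow-bound g (cover D) p<cover))) (ℕP.m≤n+m (reach D) D))

    stage : ℕ → ℕ → ℕ
    stage b zero    = suc b
    stage b (suc i) = next (stage b i)

    stage-t-step : ∀ b i → t (stage b i) ≤ t (stage b (suc i))
    stage-t-step b i = t-mono (ℕP.m≤m+n (stage b i) _)

    above-start : ∀ b i → b < stage b i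
    above-start b zero    = ℕP.≤-refl
    above-start b (suc i) = ℕP.≤-trans (above-start b i) (ℕP.m≤m+n (stage b i) _)

    plateau-search : ∀ b k → (∃[ i ] i ≤ k × t (stage b i) ≡ t (stage b (suc i))) ⊎ suc k ≤ t (stage b (suc k))
    plateau-search b = plateau-or-growth (λ i → t (stage b i)) (stage-t-step b)

    plateau : ℕ → ℕ → ℕ
    plateau b k with plateau-search b k
    ... | inj₁ (i , _) = i
    ... | inj₂ _       = zero

    plateau-vanishes : ∀ b k → ¬ (suc k ≤ t (stage b (suc k))) → psum y (cover (stage b (plateau b k))) ≡ 0ℚ
    plateau-vanishes b k not-grown with plateau-search b k
    ... | inj₁ (i , _ , flat) = window-vanishes (stage b i) flat
    ... | inj₂ grown          = ⊥-elim (not-grown grown)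

    -- The bracketing points: after f k, cut at the window of the first plateau beyond f k.
    f : ℕ → ℕ
    f zero    = zero
    f (suc k) = cover (stage (f k) (plateau (f k) k))

    f-increasing : StrictlyIncreasing f
    f-increasing k = ℕP.<-≤-trans (above-start (f k) (plateau (f k) k)) (≤-cover _)

    -- Pseudoboundedness, applied to the values t (stage (f k) (k+1)) ∈ S, rules out
    -- growth by k+1 for large k; so the bracketed partial sums are eventually 0.
    convergent-bracketing : Pseudobounded s → HasConvergentBracketing y
    convergent-bracketing pseudobounded with pseudobounded (λ k → t (stage (f k) (suc k))) (λ k → t-in-S (stage (f k) (suc k)))
    ... | N , small = f , refl , f-increasing , eventually-zero⇒converges (bracket y f) (suc N) vanishes
      where
      vanishes : ∀ m → suc N ≤ m → psum (bracket y f) m ≡ 0ℚ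
      vanishes (suc k) (s≤s N≤k) = trans (psum-bracket y f refl f-increasing (suc k))
        (plateau-vanishes (f k) k (ℕP.<⇒≱ (small k N≤k)))

lemma4p2 : (s : ℕ → ℕ) → Pseudobounded s →
    Σ (ℕ → ℚ) λ a →
      ((n : ℕ) → 0ℚ ≤ℚ a n) ×
      (SeriesConverges (altSign a) × WeakPermutablyConvergent (altSign a)) ×
      (SeriesConverges a → Bounded s)
lemma4p2 s pseudobounded =
  a , (λ n → c-nonneg ⌊ n /2⌋) ,
  (x-converges , x-converges , λ σ → Rearrangement.convergent-bracketing σ pseudobounded) ,
  bounded
  where open Construction s
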